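{- Let $P \in \mathcal{C}(G_n)$, and let $k \in Q_n$. Then the following are equivalent: (1) The set $Q_n - \{k\}$ is separable with respect to $P$. (2) The $k^{th}$ column of $P$ is of the form $\vec{w} = \begin{pmatrix} 1 & 0 & 0 & 1 & 1 & \cdots & 0 & 0 & 1 \end{pmatrix}^\top$ or its bitwise complement. (3) The matrix $P$ is equal to $\mathrm{weave}_k^1(P_1)$ or $\mathrm{weave}_k^0(P_1)$ for some $P_1 \in \mathcal{C}(G_{n-1})$.
   Context: Let $Q_n=\{1,\dots,n\}$ be a set of $n$ yes/no questions; an outcome on $S\subseteq Q_n$ is an element of $\{0,1\}^{|S|}$. A preference matrix on $Q_n$ is a $2^n\times n$ 0-1 matrix whose rows are the $2^n$ outcomes, each exactly once, ordered from most to least preferred. For a nonempty proper $S\subset Q_n$ and outcome $x$ on $Q_n-S$, $P^{[Q_n-S,x]}$ is the submatrix formed by the columns in $S$ and rows with outcome $x$ on $Q_n-S$ (in order); $S$ is separable with respect to $P$ if all these submatrices coincide for all $x$. $\mathcal{C}(G_n)$ is the set of preference matrices generated by Hamiltonian paths in the $n$-dimensional hypercube graph $G_n$ with Gray code labeling, i.e. preference matrices in which consecutive rows differ in exactly one entry. For $A\in\mathcal{C}(G_{n-1})$ and $k\in\{1,\dots,n\}$, $\mathrm{weave}_k^1(A)$ is the $2^{n}\times n$ matrix obtained by duplicating each row of $A$ (rows $2i-1$ and $2i$ both equal row $i$ of $A$) and inserting a new column in position $k$ (shifting later columns right) whose $i$-th entry is $1$ if $i\equiv 0,1 \pmod 4$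 and $0$ if $i\equiv 2,3\pmod 4$; $\mathrm{weave}_k^0(A)$ is the same with the new column bitwise complemented. In (2), $\vec w$ has $i$-th entry $1$ if $i\equiv 0,1\pmod 4$ and $0$ if $i\equiv 2,3 \pmod 4$. -}

module Defs where

open import Data.Bool using (Bool; true; false; not; _∨_; if_then_else_)
open import Data.Nat using (ℕ; zero; suc; _+_; _^_; _%_; _≡ᵇ_)
open import Data.Fin using (Fin)
open import Data.Fin.Subset using (Subset; ∁; ∣_∣; Nonempty)
open import Data.Vec using (Vec; []; _∷_; lookup; insertAt; toList)
open import Data.List using (List; []; _∷_; length; map; filter)
open import Data.List.Properties using (≡-dec)
open import Data.List.Membership.Propositional using (_∈_)
open import Data.List.Relation.Unary.Unique.Propositional using (Unique)
open import Data.List.Relation.Unary.Linked using (Linked)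
open import Relation.Binary.PropositionalEquality using (_≡_)
import Data.Bool as B

-- An outcome on Q_n: a 0-1 vector of length n (true = 1, false = 0).
Outcome : ℕ → Set
Outcome n = Vec Bool n

-- A 2^n × n 0-1 matrix, given as its list of rows (top row = most preferred).
Matrix : ℕ → Set
Matrix n = List (Outcome n)

record IsPreferenceMatrix {n : ℕ} (P : Matrix n) : Set where
  field
    rows-count : length P ≡ 2 ^ n
    rows-all   : (x : Outcome n) → x ∈ P
    rows-once  : Unique P

hamming : {n : ℕ} → Outcome n → Outcome n → ℕ
hamming []       []       = 0
hamming (a ∷ u) (b ∷ v) = (if B._xor_ a b then 1 else 0) + hamming u v

Adjacent : {n : ℕ} → Outcome n → Outcome n → Set
Adjacent u v = hamming u v ≡ 1

record InC {n : ℕ} (P : Matrix n) : Set where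
  field
    pref     : IsPreferenceMatrix P
    gray     : Linked Adjacent P

restrict : {n : ℕ} → Subset n → Outcome n → List Bool
restrict []          []       = []
restrict (true ∷ s)  (b ∷ v) = b ∷ restrict s v
restrict (false ∷ s) (_ ∷ v) = restrict s v

subMatrix : {n : ℕ} → Subset n → List Bool → Matrix n → List (List Bool)
subMatrix S x P =
  map (restrict S) (filter (λ r → ≡-dec B._≟_ (restrict (∁ S) r) x) P)

Separable : {n : ℕ} → Subset n → Matrix n → Set
Separable {n} S P =
  Nonempty S × Nonempty (∁ S) ×
  ((x y : Vec Bool ∣ ∁ S ∣) → subMatrix S (toList x) P ≡ subMatrix S (toList y) P)
  where open import Data.Product using (_×_)

-- i-th entry (1-indexed) of w: 1 if i ≡ 0,1 (mod 4), 0 if i ≡ 2,3 (mod 4)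
wEntry : ℕ → Bool
wEntry i = ((i % 4) ≡ᵇ 0) ∨ ((i % 4) ≡ᵇ 1)

wFrom : ℕ → ℕ → List Bool
wFrom s zero    = []
wFrom s (suc N) = wEntry s ∷ wFrom (suc s) N

w : ℕ → List Bool
w N = wFrom 1 N

column : {n : ℕ} → Fin n → Matrix n → List Bool
column k P = map (λ r → lookup r k) P

dup : {A : Set} → List A → List A
dup []       = []
dup (r ∷ rs) = r ∷ r ∷ dup rs

insCol : {m : ℕ} → Fin (suc m) → (ℕ → Bool) → ℕ → List (Outcome m) → Matrix (suc m)
insCol k f s []       = []
insCol k f s (r ∷ rs) = insertAt r k (f s) ∷ insCol k f (suc s) rs

-- weave^b_k(A): b = true gives weave^1, b = false gives weave^0
weave : {m : ℕ} → Bool → Fin (suc m) → Matrix m → Matrix (suc m)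
weave true  k A = insCol k wEntry 1 (dup A)
weave false k A = insCol k (λ i → not (wEntry i)) 1 (dup A)

module Submission where

-- Split every row at column k into its label (the k-th entry) and its rest. Separability of
-- Q_n − {k} says that the rows labelled 1 and the rows labelled 0 list the same rests in the same
-- order. In a Gray path, consecutive rows with different labels have equal rests; together with
-- the uniqueness of rows this forces P to be a sequence of pairs (u labelled c, u labelled ¬c)
-- whose labels run c ¬c ¬c c c ¬c …, i.e. P = weave_k^c(A). Conversely such a P is separable,
-- its k-th column is w or its complement, and A inherits being a Gray preference matrix from P.

open import Defs
open import Algebra.Properties.CommutativeSemigroup using (x∙yz≈y∙xz)
open import Data.Bool using (Bool; true; false; not; _xor_; if_then_else_; _≟_)
open import Data.Bool.Properties using (not-involutive; not-¬; ¬-not)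
open import Data.Empty using (⊥-elim)
open import Data.Fin using (Fin; zero; suc)
open import Data.Fin.Subset using (Subset; ∁; ⁅_⁆; ∣_∣; Nonempty)
import Data.Fin.Subset as Subset
open import Data.Fin.Subset.Properties using (x∈⁅x⁆; ∣⁅x⁆∣≡1)
open import Data.List using (List; []; _∷_; map; filter; length)
open import Data.List.Membership.Propositional using (_∈_)
open import Data.List.Properties
  using ( ∷-injectiveˡ; ∷-injectiveʳ; ≡-dec; filter-accept; filter-reject; filter-≐
        ; map-cong; map-∘; map-injective)
open import Data.List.Relation.Unary.All using (All)
import Data.List.Relation.Unary.All as All
open import Data.List.Relation.Unary.All.Properties using (All¬⇒¬Any)
open import Data.List.Relation.Unary.AllPairs using ([]; _∷_)
open import Data.List.Relation.Unary.Any using (Any; here; there)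
import Data.List.Relation.Unary.Any as Any
open import Data.List.Relation.Unary.Linked using (Linked; []; [-]; _∷_)
import Data.List.Relation.Unary.Linked as Linked
open import Data.List.Relation.Unary.Unique.Propositional using (Unique)
open import Data.Nat using (ℕ; zero; suc; _+_; _*_; _^_; _≤_; s≤s; z≤n)
open import Data.Nat.Properties using (suc-injective; *-suc; *-cancelˡ-≡; +-commutativeSemigroup)
open import Data.Product using (Σ; ∃; _×_; _,_; proj₁; proj₂)
open import Data.Sum using (_⊎_; inj₁; inj₂)
open import Data.Vec using (Vec; []; _∷_; lookup; insertAt; removeAt; toList)
import Data.Vec as Vec
open import Data.Vec.Properties
  using (insertAt-lookup; removeAt-insertAt; insertAt-removeAt; toList-injective; cast-is-id)
open import Function using (_∘_)
open import Function.Bundles using (_⇔_; mk⇔)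
import Function.Properties.Equivalence as ⇔
open import Relation.Binary.PropositionalEquality
open import Relation.Nullary using (¬_; yes; no)

≡not⇒≢ : ∀ {x y} → x ≡ not y → x ≢ y
≡not⇒≢ x≡¬y x≡y = not-¬ refl (trans (sym x≡y) x≡¬y)

mismatch : Bool → Bool → ℕ
mismatch a b = if a xor b then 1 else 0

mismatch-≡ : ∀ {a b} → a ≡ b → mismatch a b ≡ 0
mismatch-≡ {true} refl = refl
mismatch-≡ {false} refl = refl

mismatch-≢ : ∀ {a b} → a ≢ b → mismatch a b ≡ 1
mismatch-≢ {true} {true} a≢b = ⊥-elim (a≢b refl)
mismatch-≢ {true} {false} _ = refl
mismatch-≢ {false} {true} _ = refl
mismatch-≢ {false} {false} a≢b = ⊥-elim (a≢b refl)

hamming≡0⇒≡ : ∀ {n} (u v : Vec Bool n) → hamming u v ≡ 0 → u ≡ v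
hamming≡0⇒≡ [] [] _ = refl
hamming≡0⇒≡ (true ∷ u) (true ∷ v) eq = cong (true ∷_) (hamming≡0⇒≡ u v eq)
hamming≡0⇒≡ (false ∷ u) (false ∷ v) eq = cong (false ∷_) (hamming≡0⇒≡ u v eq)

hamming-removeAt : ∀ {m} (k : Fin (suc m)) (r s : Vec Bool (suc m)) →
  hamming r s ≡ mismatch (lookup r k) (lookup s k) + hamming (removeAt r k) (removeAt s k)
hamming-removeAt zero (a ∷ u) (b ∷ v) = refl
hamming-removeAt (suc k) (a ∷ a′ ∷ u) (b ∷ b′ ∷ v) = trans
  (cong (mismatch a b +_) (hamming-removeAt k (a′ ∷ u) (b′ ∷ v)))
  (x∙yz≈y∙xz +-commutativeSemigroup (mismatch a b)
    (mismatch (lookup (a′ ∷ u) k) (lookup (b′ ∷ v) k))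
    (hamming (removeAt (a′ ∷ u) k) (removeAt (b′ ∷ v) k)))

pairColumn : Bool → ℕ → List Bool
pairColumn c zero = []
pairColumn c (suc N) = c ∷ not c ∷ pairColumn (not c) N

pairColumn-not : ∀ c N → map not (pairColumn c N) ≡ pairColumn (not c) N
pairColumn-not c zero = refl
pairColumn-not c (suc N) = cong (λ t → not c ∷ not (not c) ∷ t) (pairColumn-not (not c) N)

-- Holds by computation: (4 + i) % 4 reduces to i % 4.
wFrom-periodic : ∀ s n → wFrom (4 + s) n ≡ wFrom s n
wFrom-periodic s zero = refl
wFrom-periodic s (suc n) = cong (wEntry s ∷_) (wFrom-periodic (suc s) n)

wFrom1≡pairColumn : ∀ N → wFrom 1 (2 * N) ≡ pairColumn true N
wFrom3≡pairColumn : ∀ N → wFrom 3 (2 * N) ≡ pairColumn false N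
wFrom1≡pairColumn zero = refl
wFrom1≡pairColumn (suc N) = trans (cong (wFrom 1) (*-suc 2 N))
  (cong (λ t → true ∷ false ∷ t) (wFrom3≡pairColumn N))
wFrom3≡pairColumn zero = refl
wFrom3≡pairColumn (suc N) = trans (cong (wFrom 3) (*-suc 2 N))
  (cong (λ t → false ∷ true ∷ t) (trans (wFrom-periodic 1 (2 * N)) (wFrom1≡pairColumn N)))

w-column⇔pairColumn : ∀ N {col : List Bool} →
  (col ≡ w (2 * N) ⊎ col ≡ map not (w (2 * N))) ⇔ ∃ λ c → col ≡ pairColumn c N
w-column⇔pairColumn N = mk⇔ to from
  where
  not-w : map not (w (2 * N)) ≡ pairColumn false N
  not-w = trans (cong (map not) (wFrom1≡pairColumn N)) (pairColumn-not true N)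
  to : ∀ {col} → col ≡ w (2 * N) ⊎ col ≡ map not (w (2 * N)) → ∃ λ c → col ≡ pairColumn c N
  to (inj₁ eq) = true , trans eq (wFrom1≡pairColumn N)
  to (inj₂ eq) = false , trans eq not-w
  from : ∀ {col} → (∃ λ c → col ≡ pairColumn c N) → col ≡ w (2 * N) ⊎ col ≡ map not (w (2 * N))
  from (true , eq) = inj₁ (trans eq (sym (wFrom1≡pairColumn N)))
  from (false , eq) = inj₂ (trans eq (sym not-w))

module Split {m : ℕ} (k : Fin (suc m)) where

  Row : Set
  Row = Vec Bool (suc m)

  label : Row → Bool
  label r = lookup r k

  rest : Row → Vec Bool m
  rest r = removeAt r k

  row≡insertAt : ∀ {r u b} → rest r ≡ u → label r ≡ b → r ≡ insertAt u k b
  row≡insertAt {r} refl refl = sym (insertAt-removeAt r k)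

  row-ext : ∀ {r s} → label r ≡ label s → rest r ≡ rest s → r ≡ s
  row-ext {s = s} l≡ rest≡ = trans (row≡insertAt rest≡ l≡) (insertAt-removeAt s k)

  insertAt-injective : ∀ {u v b c} → insertAt u k b ≡ insertAt v k c → u ≡ v
  insertAt-injective {u} {v} {b} {c} eq =
    trans (sym (removeAt-insertAt u k b)) (trans (cong rest eq) (removeAt-insertAt v k c))

  adjacent-flip : ∀ r s → Adjacent r s → label r ≢ label s → rest r ≡ rest s
  adjacent-flip r s adj l≢ = hamming≡0⇒≡ (rest r) (rest s) (suc-injective (begin
    suc (hamming (rest r) (rest s))
      ≡⟨ cong (_+ hamming (rest r) (rest s)) (mismatch-≢ l≢) ⟨
    mismatch (label r) (label s) + hamming (rest r) (rest s)
      ≡⟨ hamming-removeAt k r s ⟨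
    hamming r s
      ≡⟨ adj ⟩
    1 ∎))
    where open ≡-Reasoning

  adjacent-keep : ∀ r s → Adjacent r s → label r ≡ label s → Adjacent (rest r) (rest s)
  adjacent-keep r s adj l≡ =
    trans (sym (trans (hamming-removeAt k r s)
                      (cong (_+ hamming (rest r) (rest s)) (mismatch-≡ l≡))))
          adj

  adjacent-insertAt : ∀ {u v b} → Adjacent (insertAt u k b) (insertAt v k b) → Adjacent u v
  adjacent-insertAt {u} {v} {b} adj =
    subst₂ Adjacent (removeAt-insertAt u k b) (removeAt-insertAt v k b)
      (adjacent-keep (insertAt u k b) (insertAt v k b) adj
        (trans (insertAt-lookup u k b) (sym (insertAt-lookup v k b))))

  slice : Bool → List Row → List (Vec Bool m)
  slice b L = map rest (filter (λ r → label r ≟ b) L)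

  slice-accept : ∀ {b} r L → label r ≡ b → slice b (r ∷ L) ≡ rest r ∷ slice b L
  slice-accept {b} r L l≡ = cong (map rest) (filter-accept (λ r → label r ≟ b) {r} {L} l≡)

  slice-reject : ∀ {b} r L → label r ≢ b → slice b (r ∷ L) ≡ slice b L
  slice-reject {b} r L l≢ = cong (map rest) (filter-reject (λ r → label r ≟ b) {r} {L} l≢)

  slice-pair : ∀ b c a L → slice b (insertAt a k c ∷ insertAt a k (not c) ∷ L) ≡ a ∷ slice b L
  slice-pair b c a L with c ≟ b
  ... | yes c≡b = trans (slice-accept (insertAt a k c) _ (trans (insertAt-lookup a k c) c≡b))
                        (cong₂ _∷_ (removeAt-insertAt a k c)
                                   (slice-reject (insertAt a k (not c)) L (≡not⇒≢ second)))
    where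
    second : label (insertAt a k (not c)) ≡ not b
    second = trans (insertAt-lookup a k (not c)) (cong not c≡b)
  ... | no c≢b = trans (slice-reject (insertAt a k c) _ (c≢b ∘ trans (sym (insertAt-lookup a k c))))
                       (trans (slice-accept (insertAt a k (not c)) L second)
                              (cong (_∷ _) (removeAt-insertAt a k (not c))))
    where
    second : label (insertAt a k (not c)) ≡ b
    second = trans (insertAt-lookup a k (not c)) (sym (¬-not (c≢b ∘ sym)))

  Balanced : List Row → Set
  Balanced L = slice true L ≡ slice false L

  slices-equal : ∀ L → Balanced L → ∀ b b′ → slice b L ≡ slice b′ L
  slices-equal L bal b b′ = trans (to-true b) (sym (to-true b′))
    where
    to-true : ∀ b → slice b L ≡ slice true L
    to-true true = refl
    to-true false = sym bal

  balanced : ∀ L c → slice c L ≡ slice (not c) L → Balanced L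
  balanced L true eq = eq
  balanced L false eq = sym eq

  weave′ : Bool → Matrix m → Matrix (suc m)
  weave′ c [] = []
  weave′ c (a ∷ A) = insertAt a k c ∷ insertAt a k (not c) ∷ weave′ (not c) A

  Woven : Matrix (suc m) → Set
  Woven P = Σ Bool λ c → Σ (Matrix m) λ A → P ≡ weave′ c A

  insCol-periodic : ∀ f → (∀ i → f (4 + i) ≡ f i) → ∀ s X → insCol k f (4 + s) X ≡ insCol k f s X
  insCol-periodic f periodic s [] = refl
  insCol-periodic f periodic s (r ∷ X) =
    cong₂ _∷_ (cong (insertAt r k) (periodic s)) (insCol-periodic f periodic (suc s) X)

  weave-true : ∀ A → weave true k A ≡ weave′ true A
  weave-true-from3 : ∀ A → insCol k wEntry 3 (dup A) ≡ weave′ false A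
  weave-true [] = refl
  weave-true (a ∷ A) = cong (λ t → insertAt a k true ∷ insertAt a k false ∷ t) (weave-true-from3 A)
  weave-true-from3 [] = refl
  weave-true-from3 (a ∷ A) = cong (λ t → insertAt a k false ∷ insertAt a k true ∷ t)
    (trans (insCol-periodic wEntry (λ _ → refl) 1 (dup A)) (weave-true A))

  weave-false : ∀ A → weave false k A ≡ weave′ false A
  weave-false-from3 : ∀ A → insCol k (λ i → not (wEntry i)) 3 (dup A) ≡ weave′ true A
  weave-false [] = refl
  weave-false (a ∷ A) =
    cong (λ t → insertAt a k false ∷ insertAt a k true ∷ t) (weave-false-from3 A)
  weave-false-from3 [] = refl
  weave-false-from3 (a ∷ A) = cong (λ t → insertAt a k true ∷ insertAt a k false ∷ t)
    (trans (insCol-periodic (λ i → not (wEntry i)) (λ _ → refl) 1 (dup A)) (weave-false A))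

  weave≡weave′ : ∀ b A → weave b k A ≡ weave′ b A
  weave≡weave′ true = weave-true
  weave≡weave′ false = weave-false

  length-weave′ : ∀ c A → length (weave′ c A) ≡ 2 * length A
  length-weave′ c [] = refl
  length-weave′ c (a ∷ A) =
    trans (cong (λ n → suc (suc n)) (length-weave′ (not c) A)) (sym (*-suc 2 (length A)))

  labels-weave′ : ∀ c A → map label (weave′ c A) ≡ pairColumn c (length A)
  labels-weave′ c [] = refl
  labels-weave′ c (a ∷ A) = cong₂ _∷_ (insertAt-lookup a k c)
    (cong₂ _∷_ (insertAt-lookup a k (not c)) (labels-weave′ (not c) A))

  slice-weave′ : ∀ b c A → slice b (weave′ c A) ≡ A
  slice-weave′ b c [] = refl
  slice-weave′ b c (a ∷ A) = trans (slice-pair b c a _) (cong (a ∷_) (slice-weave′ b (not c) A))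

  weave′-balanced : ∀ c A → Balanced (weave′ c A)
  weave′-balanced c A = trans (slice-weave′ true c A) (sym (slice-weave′ false c A))

  weave′-of-labels : ∀ c N L → Linked Adjacent L → map label L ≡ pairColumn c N →
    Σ (Matrix m) λ A → L ≡ weave′ c A
  weave′-of-labels c zero [] _ _ = [] , refl
  weave′-of-labels c (suc N) (r₁ ∷ r₂ ∷ L) (adj ∷ linked) labels = rest r₁ ∷ A ,
    cong₂ _∷_ (row≡insertAt refl l₁) (cong₂ _∷_ (row≡insertAt (sym rest≡) l₂) L≡)
    where
    l₁ : label r₁ ≡ c
    l₁ = ∷-injectiveˡ labels
    l₂ : label r₂ ≡ not c
    l₂ = ∷-injectiveˡ (∷-injectiveʳ labels)
    rest≡ : rest r₁ ≡ rest r₂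
    rest≡ = adjacent-flip r₁ r₂ adj (λ l₁≡l₂ → ≡not⇒≢ l₂ (trans (sym l₁≡l₂) l₁))
    tail = weave′-of-labels (not c) N L (Linked.tail linked) (∷-injectiveʳ (∷-injectiveʳ labels))
    A = proj₁ tail
    L≡ = proj₂ tail

  first-opposite : ∀ {c a as} r L → Linked Adjacent (r ∷ L) → label r ≡ c →
    slice (not c) (r ∷ L) ≡ a ∷ as → Any (λ s → label s ≡ c × rest s ≡ a) (r ∷ L)
  first-opposite r [] _ l eq with trans (sym (slice-reject r [] (not-¬ l))) eq
  ... | ()
  first-opposite {c} r (s ∷ L) (adj ∷ linked) l eq with label s ≟ c
  ... | yes l′ = there (first-opposite s L linked l′ (trans (sym (slice-reject r _ (not-¬ l))) eq))
  ... | no l′ =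
    here (l , trans (adjacent-flip r s adj (λ e → l′ (trans (sym e) l))) (∷-injectiveˡ slices))
    where
    slices = trans (sym (trans (slice-reject r _ (not-¬ l)) (slice-accept s L (¬-not l′)))) eq

  -- The first row labelled ¬c must carry rest r₁; the row before it is labelled c and adjacent
  -- to it, so it carries rest r₁ too and is a second copy of r₁.
  no-repeated-label : ∀ r₁ r₂ L → Unique (r₁ ∷ r₂ ∷ L) → Linked Adjacent (r₂ ∷ L) →
    Balanced (r₁ ∷ r₂ ∷ L) → label r₂ ≢ label r₁
  no-repeated-label r₁ r₂ L (r₁∉ ∷ _) linked bal l≡ =
    All¬⇒¬Any r₁∉ (Any.map (λ { (l , rest≡) → row-ext (sym l) (sym rest≡) }) witness)
    where
    c = label r₁
    slices : slice (not c) (r₂ ∷ L) ≡ rest r₁ ∷ slice c (r₂ ∷ L)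
    slices = trans (sym (slice-reject r₁ (r₂ ∷ L) (not-¬ refl)))
               (trans (slices-equal (r₁ ∷ r₂ ∷ L) bal (not c) c) (slice-accept r₁ (r₂ ∷ L) refl))
    witness = first-opposite r₂ L linked l≡ slices

  balanced-pair : ∀ r₁ r₂ L → Unique (r₁ ∷ r₂ ∷ L) → Linked Adjacent (r₂ ∷ L) →
    Balanced (r₁ ∷ r₂ ∷ L) → label r₂ ≡ not (label r₁) × rest r₂ ≡ rest r₁ × Balanced L
  balanced-pair r₁ r₂ L unique linked bal =
    l₂ , sym (∷-injectiveˡ slices) , balanced L c (∷-injectiveʳ slices)
    where
    open ≡-Reasoning
    c = label r₁
    l₂ : label r₂ ≡ not c
    l₂ = ¬-not (no-repeated-label r₁ r₂ L unique linked bal)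
    slices : rest r₁ ∷ slice c L ≡ rest r₂ ∷ slice (not c) L
    slices = begin
      rest r₁ ∷ slice c L            ≡⟨ cong (rest r₁ ∷_) (slice-reject r₂ L (≡not⇒≢ l₂)) ⟨
      rest r₁ ∷ slice c (r₂ ∷ L)     ≡⟨ slice-accept r₁ (r₂ ∷ L) refl ⟨
      slice c (r₁ ∷ r₂ ∷ L)          ≡⟨ slices-equal (r₁ ∷ r₂ ∷ L) bal c (not c) ⟩
      slice (not c) (r₁ ∷ r₂ ∷ L)    ≡⟨ slice-reject r₁ (r₂ ∷ L) (not-¬ refl) ⟩
      slice (not c) (r₂ ∷ L)         ≡⟨ slice-accept r₂ L l₂ ⟩
      rest r₂ ∷ slice (not c) L      ∎

  -- Otherwise r₃ would differ from r₂ only at k and hence coincide with r₁.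
  label-persists : ∀ r₁ r₂ r₃ → r₁ ≢ r₃ → label r₂ ≡ not (label r₁) → rest r₂ ≡ rest r₁ →
    Adjacent r₂ r₃ → label r₃ ≡ not (label r₁)
  label-persists r₁ r₂ r₃ r₁≢r₃ l₂ rest₂ adj with label r₃ ≟ label r₁
  ... | no l₃≢l₁ = ¬-not l₃≢l₁
  ... | yes l₃≡l₁ =
    ⊥-elim (r₁≢r₃ (row-ext (sym l₃≡l₁) (trans (sym rest₂) (adjacent-flip r₂ r₃ adj l₂≢l₃))))
    where
    l₂≢l₃ : label r₂ ≢ label r₃
    l₂≢l₃ l₂≡l₃ = ≡not⇒≢ l₂ (trans l₂≡l₃ l₃≡l₁)

  singleton-unbalanced : ∀ r → ¬ Balanced (r ∷ [])
  singleton-unbalanced r bal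
    with trans (sym (slice-accept r [] refl))
               (trans (slices-equal (r ∷ []) bal (label r) (not (label r)))
                      (slice-reject r [] (not-¬ refl)))
  ... | ()

  woven-from : ∀ {c} r L → label r ≡ c → Unique (r ∷ L) → Linked Adjacent (r ∷ L) →
    Balanced (r ∷ L) → Σ (Matrix m) λ A → r ∷ L ≡ weave′ c A
  woven-from r [] _ _ _ bal = ⊥-elim (singleton-unbalanced r bal)
  woven-from r₁ (r₂ ∷ []) refl unique (_ ∷ linked) bal = rest r₁ ∷ [] ,
    cong₂ _∷_ (row≡insertAt refl refl)
              (cong (_∷ []) (row≡insertAt (proj₁ (proj₂ pair)) (proj₁ pair)))
    where
    pair = balanced-pair r₁ r₂ [] unique linked bal
  woven-from r₁ (r₂ ∷ r₃ ∷ L) refl unique@(r₁∉ ∷ _ ∷ unique₃) (_ ∷ linked) bal = rest r₁ ∷ A ,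
    cong₂ _∷_ (row≡insertAt refl refl) (cong₂ _∷_ (row≡insertAt rest₂ l₂) L≡)
    where
    pair = balanced-pair r₁ r₂ (r₃ ∷ L) unique linked bal
    l₂ = proj₁ pair
    rest₂ = proj₁ (proj₂ pair)
    l₃ = label-persists r₁ r₂ r₃ (All.head (All.tail r₁∉)) l₂ rest₂ (Linked.head linked)
    tail = woven-from r₃ L l₃ unique₃ (Linked.tail linked) (proj₂ (proj₂ pair))
    A = proj₁ tail
    L≡ = proj₂ tail

  balanced⇔woven : ∀ P → Unique P → Linked Adjacent P → Balanced P ⇔ Woven P
  balanced⇔woven P unique linked = mk⇔ (to P unique linked) from
    where
    to : ∀ P → Unique P → Linked Adjacent P → Balanced P → Woven P
    to [] _ _ _ = true , [] , refl
    to (r ∷ L) unique linked bal = label r , woven-from r L refl unique linked bal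
    from : Woven P → Balanced P
    from (c , A , refl) = weave′-balanced c A

  woven⇔w-column : ∀ N P → length P ≡ 2 * N → Linked Adjacent P →
    Woven P ⇔ (column k P ≡ w (2 * N) ⊎ column k P ≡ map not (w (2 * N)))
  woven⇔w-column N P len linked =
    ⇔.trans (mk⇔ to from) (⇔.sym (w-column⇔pairColumn N))
    where
    to : Woven P → ∃ λ c → column k P ≡ pairColumn c N
    to (c , A , refl) = c , trans (labels-weave′ c A)
      (cong (pairColumn c) (*-cancelˡ-≡ (length A) N 2 (trans (sym (length-weave′ c A)) len)))
    from : (∃ λ c → column k P ≡ pairColumn c N) → Woven P
    from (c , labels) = c , weave′-of-labels c N P linked labels

  ∈-weave′⁺ : ∀ {a} b c A → a ∈ A → insertAt a k b ∈ weave′ c A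
  ∈-weave′⁺ b c (_ ∷ A) (here refl) with b ≟ c
  ... | yes refl = here refl
  ... | no b≢c = there (here (cong (insertAt _ k) (¬-not b≢c)))
  ∈-weave′⁺ b c (_ ∷ A) (there a∈A) = there (there (∈-weave′⁺ b (not c) A a∈A))

  ∈-weave′⁻ : ∀ {a b} c A → insertAt a k b ∈ weave′ c A → a ∈ A
  ∈-weave′⁻ c (_ ∷ A) (here eq) = here (insertAt-injective eq)
  ∈-weave′⁻ c (_ ∷ A) (there (here eq)) = here (insertAt-injective eq)
  ∈-weave′⁻ c (_ ∷ A) (there (there p)) = there (∈-weave′⁻ (not c) A p)

  weave′-unique⁻ : ∀ c A → Unique (weave′ c A) → Unique A
  weave′-unique⁻ c [] _ = []
  weave′-unique⁻ c (a ∷ A) (a∉ ∷ _ ∷ unique) = All.tabulate a≢ ∷ weave′-unique⁻ (not c) A unique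
    where
    a≢ : ∀ {a′} → a′ ∈ A → a ≢ a′
    a≢ a′∈A refl = All.lookup a∉ (there (∈-weave′⁺ c (not c) A a′∈A)) refl

  weave′-linked⁻ : ∀ c A → Linked Adjacent (weave′ c A) → Linked Adjacent A
  weave′-linked⁻ c [] _ = []
  weave′-linked⁻ c (a ∷ []) _ = [-]
  weave′-linked⁻ c (a ∷ a′ ∷ A) (_ ∷ adj ∷ linked) =
    adjacent-insertAt adj ∷ weave′-linked⁻ (not c) (a′ ∷ A) linked

  weave′-InC⁻ : ∀ c A → InC (weave′ c A) → InC A
  weave′-InC⁻ c A inc = record
    { pref = record
      { rows-count = *-cancelˡ-≡ (length A) (2 ^ m) 2 (trans (sym (length-weave′ c A)) rows-count)
      ; rows-all = λ a → ∈-weave′⁻ c A (rows-all (insertAt a k c))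
      ; rows-once = weave′-unique⁻ c A rows-once
      }
    ; gray = weave′-linked⁻ c A gray
    }
    where
    open InC inc
    open IsPreferenceMatrix pref

  woven⇔weave : ∀ P → InC P →
    Woven P ⇔ (Σ (Matrix m) λ P₁ → InC P₁ × (P ≡ weave true k P₁ ⊎ P ≡ weave false k P₁))
  woven⇔weave P inc = mk⇔ to from
    where
    to : Woven P → Σ (Matrix m) λ P₁ → InC P₁ × (P ≡ weave true k P₁ ⊎ P ≡ weave false k P₁)
    to (true , A , refl) = A , weave′-InC⁻ true A inc , inj₁ (sym (weave≡weave′ true A))
    to (false , A , refl) = A , weave′-InC⁻ false A inc , inj₂ (sym (weave≡weave′ false A))
    from : (Σ (Matrix m) λ P₁ → InC P₁ × (P ≡ weave true k P₁ ⊎ P ≡ weave false k P₁)) → Woven P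
    from (A , _ , inj₁ eq) = true , A , trans eq (weave≡weave′ true A)
    from (A , _ , inj₂ eq) = false , A , trans eq (weave≡weave′ false A)

∁-involutive : ∀ {n} (p : Subset n) → ∁ (∁ p) ≡ p
∁-involutive [] = refl
∁-involutive (b ∷ p) = cong₂ _∷_ (not-involutive b) (∁-involutive p)

restrict-⊥ : ∀ {n} (u : Vec Bool n) → restrict Subset.⊥ u ≡ []
restrict-⊥ [] = refl
restrict-⊥ (a ∷ u) = restrict-⊥ u

restrict-∁⊥ : ∀ {n} (u : Vec Bool n) → restrict (∁ Subset.⊥) u ≡ toList u
restrict-∁⊥ [] = refl
restrict-∁⊥ (a ∷ u) = cong (a ∷_) (restrict-∁⊥ u)

restrict-⁅⁆ : ∀ {m} (k : Fin (suc m)) (r : Vec Bool (suc m)) → restrict ⁅ k ⁆ r ≡ lookup r k ∷ []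
restrict-⁅⁆ zero (a ∷ u) = cong (a ∷_) (restrict-⊥ u)
restrict-⁅⁆ {suc m} (suc k) (a ∷ u) = restrict-⁅⁆ k u

restrict-∁⁅⁆ : ∀ {m} (k : Fin (suc m)) (r : Vec Bool (suc m)) →
  restrict (∁ ⁅ k ⁆) r ≡ toList (removeAt r k)
restrict-∁⁅⁆ zero (a ∷ u) = restrict-∁⊥ u
restrict-∁⁅⁆ {suc m} (suc k) (a ∷ b ∷ u) = cong (a ∷_) (restrict-∁⁅⁆ k (b ∷ u))

∁⁅⁆-nonempty : ∀ {m} (k : Fin (suc (suc m))) → Nonempty (∁ ⁅ k ⁆)
∁⁅⁆-nonempty zero = suc zero , Vec.there Vec.here
∁⁅⁆-nonempty (suc k) = zero , Vec.here

toList-length-1 : ∀ {n} → n ≡ 1 → (x : Vec Bool n) → ∃ λ b → toList x ≡ b ∷ []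
toList-length-1 refl (b ∷ []) = b , refl

vector-length-1 : ∀ {n} → n ≡ 1 → (b : Bool) → ∃ λ (x : Vec Bool n) → toList x ≡ b ∷ []
vector-length-1 refl b = b ∷ [] , refl

module _ {m : ℕ} (k : Fin (suc (suc m))) where
  open Split k

  ∣∁∁⁅⁆∣≡1 : ∣ ∁ (∁ ⁅ k ⁆) ∣ ≡ 1
  ∣∁∁⁅⁆∣≡1 = trans (cong ∣_∣ (∁-involutive ⁅ k ⁆)) (∣⁅x⁆∣≡1 k)

  subMatrix≡slice : ∀ b P → subMatrix (∁ ⁅ k ⁆) (b ∷ []) P ≡ map toList (slice b P)
  subMatrix≡slice b P = begin
    map (restrict (∁ ⁅ k ⁆)) (filter (λ r → ≡-dec _≟_ (restrict (∁ (∁ ⁅ k ⁆)) r) (b ∷ [])) P)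
      ≡⟨ cong (map (restrict (∁ ⁅ k ⁆))) (filter-≐ _ (λ r → label r ≟ b) (to , from) P) ⟩
    map (restrict (∁ ⁅ k ⁆)) (filter (λ r → label r ≟ b) P)
      ≡⟨ map-cong (restrict-∁⁅⁆ k) _ ⟩
    map (toList ∘ rest) (filter (λ r → label r ≟ b) P)
      ≡⟨ map-∘ _ ⟩
    map toList (slice b P) ∎
    where
    open ≡-Reasoning
    kth : ∀ r → restrict (∁ (∁ ⁅ k ⁆)) r ≡ label r ∷ []
    kth r = trans (cong (λ S → restrict S r) (∁-involutive ⁅ k ⁆)) (restrict-⁅⁆ k r)
    to : ∀ {r} → restrict (∁ (∁ ⁅ k ⁆)) r ≡ b ∷ [] → label r ≡ b
    to {r} eq = ∷-injectiveˡ (trans (sym (kth r)) eq)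
    from : ∀ {r} → label r ≡ b → restrict (∁ (∁ ⁅ k ⁆)) r ≡ b ∷ []
    from {r} eq = trans (kth r) (cong (_∷ []) eq)

  separable⇔balanced : ∀ P → Separable (∁ ⁅ k ⁆) P ⇔ Balanced P
  separable⇔balanced P = mk⇔ to from
    where
    sub≡ : ∀ {x b} → toList x ≡ b ∷ [] → subMatrix (∁ ⁅ k ⁆) (toList x) P ≡ map toList (slice b P)
    sub≡ {b = b} eq = trans (cong (λ x → subMatrix (∁ ⁅ k ⁆) x P) eq) (subMatrix≡slice b P)
    to : Separable (∁ ⁅ k ⁆) P → Balanced P
    to (_ , _ , separable) =
      map-injective (λ {u} {v} e → trans (sym (cast-is-id refl u)) (toList-injective refl u v e))
        (trans (sym (sub≡ (proj₂ x₁))) (trans (separable (proj₁ x₁) (proj₁ x₀)) (sub≡ (proj₂ x₀))))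
      where
      x₁ = vector-length-1 ∣∁∁⁅⁆∣≡1 true
      x₀ = vector-length-1 ∣∁∁⁅⁆∣≡1 false
    from : Balanced P → Separable (∁ ⁅ k ⁆) P
    from bal = ∁⁅⁆-nonempty k , (k , k∈) ,
      λ x y → slices (toList-length-1 ∣∁∁⁅⁆∣≡1 x) (toList-length-1 ∣∁∁⁅⁆∣≡1 y)
      where
      k∈ = subst (k Subset.∈_) (sym (∁-involutive ⁅ k ⁆)) (x∈⁅x⁆ k)
      slices : ∀ {x y} → ∃ (λ b → toList x ≡ b ∷ []) → ∃ (λ b → toList y ≡ b ∷ []) →
        subMatrix (∁ ⁅ k ⁆) (toList x) P ≡ subMatrix (∁ ⁅ k ⁆) (toList y) P
      slices (b , x≡) (b′ , y≡) =
        trans (sub≡ x≡) (trans (cong (map toList) (slices-equal P bal b b′)) (sym (sub≡ y≡)))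

theorem7 : (m : ℕ) → 1 ≤ m → (P : Matrix (suc m)) → InC P → (k : Fin (suc m))
  → (Separable (∁ ⁅ k ⁆) P ⇔ (column k P ≡ w (2 ^ suc m) ⊎ column k P ≡ map not (w (2 ^ suc m))))
  × ((column k P ≡ w (2 ^ suc m) ⊎ column k P ≡ map not (w (2 ^ suc m)))
     ⇔ (Σ (Matrix m) λ P₁ → InC P₁ × (P ≡ weave true k P₁ ⊎ P ≡ weave false k P₁)))
theorem7 m@(suc _) (s≤s z≤n) P inc k =
    ⇔.trans (separable⇔balanced k P) (⇔.trans (balanced⇔woven P rows-once gray) woven⇔column)
  , ⇔.trans (⇔.sym woven⇔column) (woven⇔weave P inc)
  where
  open Split k
  open InC inc
  open IsPreferenceMatrix pref
  woven⇔column = woven⇔w-column (2 ^ m) P rows-count gray
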